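{- Let $G$ be a triangle-free super-minimally $3$-connected graph and let $ab$ be an edge of $G$ such that $G\setminus ab$ is internally $3$-connected. Then $G\backslash\backslash ab$ is $3$-connected.
   Context: All graphs are finite and simple. A graph is $3$-connected if it has more than $3$ vertices and no vertex cut of size less than $3$; super-minimally $3$-connected if it is $3$-connected and no proper subgraph is $3$-connected. A $2$-separation of $G$ is a pair $\{G_1,G_2\}$ of edge-disjoint subgraphs with $G_1\cup G_2=G$, $|V(G_1)\cap V(G_2)|=2$, $\min\{|V(G_1)|,|V(G_2)|\}\ge 3$ (isolated vertices allowed); a $2$-connected graph with at least four vertices is internally $3$-connected if for every $2$-separation one side is isomorphic to the $3$-vertex path $P_3$. For an edge $xy$ of a $3$-connected graph $G$, the enhanced deletion $G\backslash\backslash xy$ is defined as follows: (i) if in $G\setminus xy$ we have $N(x)=\{a,b\}$ and $N(y)=\{c,d\}$ where $\{a,b\}$ and $\{c,d\}$ are disjoint pairs of nonadjacent vertices, then $G\backslash\backslash xy=(G-\{x,y\})+ab+cd$; (ii) if for exactly one $z\in\{x,y\}$ the neighborhood of $z$ in $G\setminus xy$ consists of exactly two vertices $a,b$ and these are nonadjacent, then $G\backslash\backslash xy=(G-z)+ab$; (iii) otherwise $G\backslash\backslash xy=G\setminus xy$. Here $+ab$ means adding the edge $ab$. -}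

module Defs where

open import Data.Nat using (ℕ; zero; suc; _+_; _≤_; _<_)
open import Data.Fin using (Fin; zero; suc; _≟_)
open import Data.Bool using (Bool; true; false; _∧_; _∨_; not; if_then_else_)
open import Data.Product using (Σ; ∃; ∃-syntax; _×_; _,_)
open import Data.Sum using (_⊎_)
open import Relation.Nullary using (¬_)
open import Relation.Nullary.Decidable using (⌊_⌋)
open import Relation.Binary.PropositionalEquality using (_≡_; _≢_)
open import Function.Bundles using (_⇔_)

-- Finite graphs.  A graph lives inside the ambient vertex type Fin N:
-- V says which elements of Fin N are vertices, E is the adjacency.
-- (Raw data; simplicity is the predicate IsSimple below.)

record Graph (N : ℕ) : Set where
  constructor mkGraph
  field
    V : Fin N → Bool
    E : Fin N → Fin N → Bool
open Graph public

record IsSimple {N : ℕ} (G : Graph N) : Set where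
  field
    sym       : ∀ x y → E G x y ≡ E G y x
    irrefl    : ∀ x → E G x x ≡ false
    endpoints : ∀ x y → E G x y ≡ true → V G x ≡ true

count : {N : ℕ} → (Fin N → Bool) → ℕ
count {zero}  p = 0
count {suc N} p = (if p zero then 1 else 0) + count (λ i → p (suc i))

SameGraph : {N : ℕ} → Graph N → Graph N → Set
SameGraph H G = (∀ x → V H x ≡ V G x) × (∀ x y → E H x y ≡ E G x y)

Subgraph : {N : ℕ} → Graph N → Graph N → Set
Subgraph H G = (∀ x → V H x ≡ true → V G x ≡ true)
             × (∀ x y → E H x y ≡ true → E G x y ≡ true)

single : {N : ℕ} → Fin N → Fin N → Bool
single x u = ⌊ u ≟ x ⌋

isPair : {N : ℕ} → Fin N → Fin N → Fin N → Fin N → Bool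
isPair a b u v = (⌊ u ≟ a ⌋ ∧ ⌊ v ≟ b ⌋) ∨ (⌊ u ≟ b ⌋ ∧ ⌊ v ≟ a ⌋)

deleteVerts : {N : ℕ} → Graph N → (Fin N → Bool) → Graph N
deleteVerts G S = mkGraph (λ x → V G x ∧ not (S x))
                          (λ x y → E G x y ∧ (not (S x) ∧ not (S y)))

deleteEdge : {N : ℕ} → Graph N → Fin N → Fin N → Graph N
deleteEdge G x y = mkGraph (V G) (λ u v → E G u v ∧ not (isPair x y u v))

addEdge : {N : ℕ} → Graph N → Fin N → Fin N → Graph N
addEdge G a b = mkGraph (V G) (λ u v → E G u v ∨ isPair a b u v)

data Reach {N : ℕ} (G : Graph N) : Fin N → Fin N → Set where
  here : ∀ {u} → Reach G u u
  step : ∀ {u w v} → E G u w ≡ true → Reach G w v → Reach G u v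

Connected : {N : ℕ} → Graph N → Set
Connected G = ∀ u v → V G u ≡ true → V G v ≡ true → Reach G u v

KConnected : {N : ℕ} → ℕ → Graph N → Set
KConnected {N} k G = (k < count (V G))
               × (∀ (S : Fin N → Bool) → count S < k → Connected (deleteVerts G S))

ThreeConnected : {N : ℕ} → Graph N → Set
ThreeConnected G = KConnected 3 G

SuperMinimally3Connected : {N : ℕ} → Graph N → Set
SuperMinimally3Connected G =
  ThreeConnected G
  × (∀ H → IsSimple H → Subgraph H G → ¬ SameGraph H G → ¬ ThreeConnected H)

TriangleFree : {N : ℕ} → Graph N → Set
TriangleFree G = ¬ (∃[ x ] ∃[ y ] ∃[ z ]
  (E G x y ≡ true × E G y z ≡ true × E G x z ≡ true))

Iso : {M N : ℕ} → Graph M → Graph N → Set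
Iso {M} {N} G H = Σ (Fin M → Fin N) λ f →
    (∀ x → V G x ≡ true → V H (f x) ≡ true)
  × (∀ x y → V G x ≡ true → V G y ≡ true → f x ≡ f y → x ≡ y)
  × (∀ y → V H y ≡ true → ∃[ x ] (V G x ≡ true × f x ≡ y))
  × (∀ x y → V G x ≡ true → V G y ≡ true → E G x y ≡ E H (f x) (f y))

P3adj : Fin 3 → Fin 3 → Bool
P3adj zero (suc zero) = true
P3adj (suc zero) zero = true
P3adj (suc zero) (suc (suc zero)) = true
P3adj (suc (suc zero)) (suc zero) = true
P3adj _ _ = false

P3 : Graph 3
P3 = mkGraph (λ _ → true) P3adj

TwoSeparation : {N : ℕ} → Graph N → Graph N → Graph N → Set
TwoSeparation G G₁ G₂ =
    IsSimple G₁ × IsSimple G₂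
  × Subgraph G₁ G × Subgraph G₂ G
  × (∀ x y → E G₁ x y ≡ true → E G₂ x y ≡ false)
  × (∀ x → V G x ≡ V G₁ x ∨ V G₂ x)
  × (∀ x y → E G x y ≡ E G₁ x y ∨ E G₂ x y)
  × count (λ x → V G₁ x ∧ V G₂ x) ≡ 2
  × 3 ≤ count (V G₁) × 3 ≤ count (V G₂)

Internally3Connected : {N : ℕ} → Graph N → Set
Internally3Connected G =
    KConnected 2 G × 4 ≤ count (V G)
  × (∀ G₁ G₂ → TwoSeparation G G₁ G₂ → Iso G₁ P3 ⊎ Iso G₂ P3)

NbhdIs : {N : ℕ} → Graph N → Fin N → Fin N → Fin N → Set
NbhdIs H z a b = a ≢ b × (∀ w → (E H z w ≡ true) ⇔ (w ≡ a ⊎ w ≡ b))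

TwoNonadjNbrs : {N : ℕ} → Graph N → Fin N → Set
TwoNonadjNbrs H z = ∃[ a ] ∃[ b ] (NbhdIs H z a b × E H a b ≡ false)

CaseI : {N : ℕ} → Graph N → Fin N → Fin N → Set
CaseI G x y = ∃[ a ] ∃[ b ] ∃[ c ] ∃[ d ]
  ( NbhdIs (deleteEdge G x y) x a b × NbhdIs (deleteEdge G x y) y c d
  × E (deleteEdge G x y) a b ≡ false × E (deleteEdge G x y) c d ≡ false
  × a ≢ c × a ≢ d × b ≢ c × b ≢ d )

CaseII : {N : ℕ} → Graph N → Fin N → Fin N → Set
CaseII G x y =
    (TwoNonadjNbrs (deleteEdge G x y) x × ¬ TwoNonadjNbrs (deleteEdge G x y) y)
  ⊎ (TwoNonadjNbrs (deleteEdge G x y) y × ¬ TwoNonadjNbrs (deleteEdge G x y) x)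

data EnhancedDeletion {N : ℕ} (G : Graph N) (x y : Fin N) (H : Graph N) : Set where
  caseI   : ∀ a b c d →
            NbhdIs (deleteEdge G x y) x a b → NbhdIs (deleteEdge G x y) y c d →
            E (deleteEdge G x y) a b ≡ false → E (deleteEdge G x y) c d ≡ false →
            a ≢ c → a ≢ d → b ≢ c → b ≢ d →
            SameGraph H (addEdge (addEdge (deleteVerts G (λ u → single x u ∨ single y u)) a b) c d) →
            EnhancedDeletion G x y H
  caseII  : ∀ z z' a b →
            ((z ≡ x × z' ≡ y) ⊎ (z ≡ y × z' ≡ x)) →
            NbhdIs (deleteEdge G x y) z a b → E (deleteEdge G x y) a b ≡ false →
            ¬ TwoNonadjNbrs (deleteEdge G x y) z' →
            SameGraph H (addEdge (deleteVerts G (single z)) a b) →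
            EnhancedDeletion G x y H
  caseIII : ¬ CaseI G x y → ¬ CaseII G x y →
            SameGraph H (deleteEdge G x y) →
            EnhancedDeletion G x y H

{-# OPTIONS --safe #-}
-- Let K = G \ ab.  Removing a set S of fewer than three vertices can disconnect K only
-- when S meets V(K) in exactly two vertices {s₁, s₂}.  Then a separated pair u, v
-- yields a 2-separation of K (the component of u against the rest), and internal
-- 3-connectivity makes one side a P3, so u or v has all its K-neighbours in {s₁, s₂}.
-- Since G has minimum degree 3 and no triangles, such a vertex is an end of ab whose
-- two remaining neighbours are nonadjacent: exactly the vertices suppressed by the
-- enhanced deletion H.  A walk of K − S through a suppressed vertex is rerouted along
-- the edge H adds between its two neighbours, so H − S stays connected, and the
-- neighbours of the suppressed ends (or of the other end) give H four vertices.

module Submission where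

open import Defs
open import Data.Nat using (ℕ; zero; suc; _+_; _≤_; _<_; z≤n; s≤s)
open import Data.Nat.Properties using (+-suc; ≤-pred; _≤?_; ≰⇒>; ≤-trans; ≤-antisym; ≤-reflexive; n≤1+n; <⇒≱)
open import Data.Fin using (Fin; zero; suc; _≟_)
open import Data.Fin.Properties using (any?)
open import Data.Bool using (Bool; true; false; _∧_; _∨_; not; if_then_else_)
open import Data.Bool.Properties using (¬-not; ∨-comm; ∧-comm; ∧-zeroʳ) renaming (_≟_ to _≟ᵇ_)
import Data.Product as Product
open import Data.Product using (∃₂; ∃-syntax; _×_; _,_; proj₁; proj₂)
open import Data.Empty using (⊥; ⊥-elim)
open import Data.Sum as Sum using (_⊎_; inj₁; inj₂; [_,_]′)
open import Data.List using (List; []; _∷_; length; map; allFin)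
open import Data.List.Properties using (length-map)
open import Data.List.Relation.Unary.All as All using (All; []; _∷_)
open import Data.List.Relation.Unary.All.Properties using () renaming (map⁺ to All-map⁺)
open import Data.List.Relation.Unary.Any using (here; there)
open import Data.List.Relation.Unary.Unique.Propositional using (Unique; []; _∷_)
open import Data.List.Membership.Propositional using (_∈_; _∉_)
open import Data.List.Membership.Propositional.Properties using (∈-allFin)
open import Relation.Nullary using (¬_; Dec; yes; no; contradiction)
open import Relation.Nullary.Decidable using (⌊_⌋; map′; _⊎-dec_; _×-dec_; ¬?; decidable-stable)
open import Relation.Binary.PropositionalEquality
  using (_≡_; _≢_; _≗_; refl; sym; trans; cong; cong₂; subst; module ≡-Reasoning)
open import Function.Base using (case_of_; _∘_)
open import Function.Bundles using (mk⇔; Equivalence)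

∧-true⁻ : ∀ {x y} → x ∧ y ≡ true → x ≡ true × y ≡ true
∧-true⁻ {true} p = refl , p

∧-true⁺ : ∀ {x y} → x ≡ true → y ≡ true → x ∧ y ≡ true
∧-true⁺ refl p = p

∨-true⁻ : ∀ {x y} → x ∨ y ≡ true → x ≡ true ⊎ y ≡ true
∨-true⁻ {true}  _ = inj₁ refl
∨-true⁻ {false} p = inj₂ p

∨-trueˡ : ∀ {x} y → x ≡ true → x ∨ y ≡ true
∨-trueˡ _ refl = refl

∨-trueʳ : ∀ x {y} → y ≡ true → x ∨ y ≡ true
∨-trueʳ true  _ = refl
∨-trueʳ false p = p

not-true⁻ : ∀ {x} → not x ≡ true → x ≡ false
not-true⁻ {false} _ = refl

≡true⇒≢false : ∀ {x} → x ≡ true → x ≢ false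
≡true⇒≢false refl ()

module _ {N : ℕ} where

  single-true⁻ : ∀ {s t : Fin N} → single s t ≡ true → t ≡ s
  single-true⁻ {s} {t} p with t ≟ s
  ... | yes t≡s = t≡s

  single-self : ∀ (s : Fin N) → single s s ≡ true
  single-self s with s ≟ s
  ... | yes _  = refl
  ... | no s≢s = contradiction refl s≢s

  single-false : ∀ {s t : Fin N} → t ≢ s → single s t ≡ false
  single-false {s} {t} t≢s = ¬-not (λ p → t≢s (single-true⁻ p))

  pair : Fin N → Fin N → Fin N → Bool
  pair s₁ s₂ t = single s₁ t ∨ single s₂ t

  pair-true⁻ : ∀ s₁ s₂ {t} → pair s₁ s₂ t ≡ true → t ≡ s₁ ⊎ t ≡ s₂
  pair-true⁻ _ _ p with ∨-true⁻ p
  ... | inj₁ q = inj₁ (single-true⁻ q)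
  ... | inj₂ q = inj₂ (single-true⁻ q)

  pair-true⁺ : ∀ s₁ s₂ {t} → t ≡ s₁ ⊎ t ≡ s₂ → pair s₁ s₂ t ≡ true
  pair-true⁺ s₁ s₂ (inj₁ refl) = ∨-trueˡ (single s₂ s₁) (single-self s₁)
  pair-true⁺ s₁ s₂ (inj₂ refl) = ∨-trueʳ (single s₁ s₂) (single-self s₂)

  pair-false : ∀ {s₁ s₂ t} → t ≢ s₁ → t ≢ s₂ → pair s₁ s₂ t ≡ false
  pair-false {s₁} {s₂} t≢s₁ t≢s₂ = ¬-not λ p → [ t≢s₁ , t≢s₂ ]′ (pair-true⁻ s₁ s₂ p)

single-suc : ∀ {N} (s t : Fin N) → single (suc s) (suc t) ≡ single s t
single-suc s t with t ≟ s
... | yes _ = refl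
... | no _  = refl

_∖_ : ∀ {N} → (Fin N → Bool) → Fin N → Fin N → Bool
(p ∖ a) t = not (single a t) ∧ p t

count-cong : ∀ {N} {p q : Fin N → Bool} → p ≗ q → count p ≡ count q
count-cong {zero}          p≗q = refl
count-cong {suc N} {p} {q} p≗q rewrite p≗q zero = cong (_ +_) (count-cong (λ t → p≗q (suc t)))

count-∖ : ∀ {N} (p : Fin N → Bool) {a} → p a ≡ true → count p ≡ suc (count (p ∖ a))
count-∖ {suc N} p {zero}  pa rewrite pa = refl
count-∖ {suc N} p {suc a} pa = begin
  head + count (λ t → p (suc t))                                ≡⟨ cong (head +_) (count-∖ (λ t → p (suc t)) pa) ⟩
  head + suc (count ((λ t → p (suc t)) ∖ a))                    ≡⟨ +-suc head _ ⟩
  suc (head + count ((λ t → p (suc t)) ∖ a))                    ≡⟨ cong (λ n → suc (head + n)) (count-cong shift) ⟩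
  suc (head + count (λ t → not (single (suc a) (suc t)) ∧ p (suc t))) ∎
  where
  open ≡-Reasoning
  head : ℕ
  head = if p zero then 1 else 0
  shift : ((λ t → p (suc t)) ∖ a) ≗ (λ t → not (single (suc a) (suc t)) ∧ p (suc t))
  shift t = cong (λ b → not b ∧ p (suc t)) (sym (single-suc a t))

∖-absent : ∀ {N} {p : Fin N → Bool} {a} → p a ≡ false → (p ∖ a) ≗ p
∖-absent {a = a} pa t with t ≟ a
... | yes refl = sym pa
... | no _     = refl

count-∖-≤ : ∀ {N} {p : Fin N → Bool} a → count p ≤ suc (count (p ∖ a))
count-∖-≤ {p = p} a with p a in pa
... | true  = ≤-reflexive (count-∖ p pa)
... | false = ≤-trans (≤-reflexive (count-cong (λ t → sym (∖-absent {p = p} pa t)))) (n≤1+n _)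

count-empty : ∀ {N} {p : Fin N → Bool} → (∀ t → p t ≢ true) → count p ≡ 0
count-empty {zero}        none = refl
count-empty {suc N} {p} none with p zero in p0
... | true  = contradiction p0 (none zero)
... | false = count-empty (λ t → none (suc t))

count-mono : ∀ {N} {p q : Fin N → Bool} → (∀ t → p t ≡ true → q t ≡ true) → count p ≤ count q
count-mono {zero}          p⊆q = z≤n
count-mono {suc N} {p} {q} p⊆q with p zero in p0 | q zero in q0
... | true  | true  = s≤s (count-mono (λ t → p⊆q (suc t)))
... | true  | false = contradiction (trans (sym (p⊆q zero p0)) q0) λ ()
... | false | true  = ≤-trans (count-mono (λ t → p⊆q (suc t))) (n≤1+n _)
... | false | false = count-mono (λ t → p⊆q (suc t))

length≤count : ∀ {N} {p : Fin N → Bool} {xs} → Unique xs → All (λ t → p t ≡ true) xs → length xs ≤ count p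
length≤count []                    []                    = z≤n
length≤count {p = p} {x ∷ xs} (x∉xs ∷ unique) (px ∷ pxs) =
  ≤-trans (s≤s (length≤count unique (All.zipWith keep (x∉xs , pxs)))) (≤-reflexive (sym (count-∖ p px)))
  where
  keep : ∀ {t} → x ≢ t × p t ≡ true → (p ∖ x) t ≡ true
  keep (x≢t , pt) = ∧-true⁺ (cong not (single-false (λ t≡x → x≢t (sym t≡x)))) pt

distinct₃ : ∀ {A : Set} {a b c : A} → a ≢ b → a ≢ c → b ≢ c → Unique (a ∷ b ∷ c ∷ [])
distinct₃ a≢b a≢c b≢c = (a≢b ∷ a≢c ∷ []) ∷ (b≢c ∷ []) ∷ [] ∷ []

distinct₄ : ∀ {A : Set} {a b c d : A} → a ≢ b → a ≢ c → a ≢ d → b ≢ c → b ≢ d → c ≢ d →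
            Unique (a ∷ b ∷ c ∷ d ∷ [])
distinct₄ a≢b a≢c a≢d b≢c b≢d c≢d = (a≢b ∷ a≢c ∷ a≢d ∷ []) ∷ distinct₃ b≢c b≢d c≢d

count≤length : ∀ {N} {p : Fin N → Bool} {xs} → (∀ t → p t ≡ true → t ∈ xs) → count p ≤ length xs
count≤length {xs = []}     cover = ≤-reflexive (count-empty λ t pt → case cover t pt of λ ())
count≤length {p = p} {x ∷ xs} cover = ≤-trans (count-∖-≤ x) (s≤s (count≤length cover′))
  where
  cover′ : ∀ t → (p ∖ x) t ≡ true → t ∈ xs
  cover′ t pt with ∧-true⁻ pt
  ... | t∉x , pt′ with cover t pt′
  ... | here refl  = contradiction (not-true⁻ t∉x) (≡true⇒≢false (single-self t))
  ... | there t∈xs = t∈xs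

module _ {N : ℕ} where

  open import Data.List.Membership.DecPropositional (_≟_ {N}) using (_∈?_)

  ∃-outside : ∀ {p : Fin N → Bool} {xs} → length xs < count p → ∃[ t ] (p t ≡ true × t ∉ xs)
  ∃-outside {p} {xs} xs<p with any? (λ t → (p t ≟ᵇ true) ×-dec ¬? (t ∈? xs))
  ... | yes found = found
  ... | no  none  = contradiction (count≤length cover) (<⇒≱ xs<p)
    where
    cover : ∀ t → p t ≡ true → t ∈ xs
    cover t pt = decidable-stable (t ∈? xs) (λ t∉xs → none (t , pt , t∉xs))

  count-pair : ∀ {s₁ s₂ : Fin N} → s₁ ≢ s₂ → count (pair s₁ s₂) ≡ 2
  count-pair {s₁} {s₂} s₁≢s₂ =
    ≤-antisym (count≤length cover) (length≤count ((s₁≢s₂ ∷ []) ∷ [] ∷ []) members)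
    where
    cover : ∀ t → pair s₁ s₂ t ≡ true → t ∈ s₁ ∷ s₂ ∷ []
    cover t pt with pair-true⁻ s₁ s₂ pt
    ... | inj₁ t≡s₁ = here t≡s₁
    ... | inj₂ t≡s₂ = there (here t≡s₂)
    members : All (λ t → pair s₁ s₂ t ≡ true) (s₁ ∷ s₂ ∷ [])
    members = pair-true⁺ s₁ s₂ (inj₁ refl) ∷ pair-true⁺ s₁ s₂ (inj₂ refl) ∷ []

  count≡2⇒pair : ∀ {p : Fin N → Bool} → count p ≡ 2 → ∃₂ λ s₁ s₂ → s₁ ≢ s₂ × p ≗ pair s₁ s₂
  count≡2⇒pair {p} p≡2 with ∃-outside {p} {[]} (subst (0 <_) (sym p≡2) (s≤s z≤n))
  ... | s₁ , ps₁ , _ with ∃-outside {p} {s₁ ∷ []} (subst (1 <_) (sym p≡2) (s≤s (s≤s z≤n)))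
  ... | s₂ , ps₂ , s₂∉ = s₁ , s₂ , s₁≢s₂ , p≗pair
    where
    s₁≢s₂ : s₁ ≢ s₂
    s₁≢s₂ s₁≡s₂ = s₂∉ (here (sym s₁≡s₂))
    no-third : ∀ {t} → p t ≡ true → t ≢ s₁ → t ≢ s₂ → ⊥
    no-third pt t≢s₁ t≢s₂ with subst (3 ≤_) p≡2 (length≤count {p = p}
      (distinct₃ s₁≢s₂ (t≢s₁ ∘ sym) (t≢s₂ ∘ sym)) (ps₁ ∷ ps₂ ∷ pt ∷ []))
    ... | s≤s (s≤s ())
    p≗pair : p ≗ pair s₁ s₂
    p≗pair t = by-cases (t ≟ s₁) (t ≟ s₂)
      where
      by-cases : Dec (t ≡ s₁) → Dec (t ≡ s₂) → p t ≡ pair s₁ s₂ t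
      by-cases (yes refl) _          = trans ps₁ (sym (pair-true⁺ s₁ s₂ (inj₁ refl)))
      by-cases (no _)     (yes refl) = trans ps₂ (sym (pair-true⁺ s₁ s₂ (inj₂ refl)))
      by-cases (no t≢s₁)  (no t≢s₂)  =
        trans (¬-not λ pt → no-third pt t≢s₁ t≢s₂) (sym (pair-false t≢s₁ t≢s₂))

module _ {N : ℕ} where

  _◅◅_ : ∀ {G : Graph N} {u w v} → Reach G u w → Reach G w v → Reach G u v
  here       ◅◅ r = r
  step e r′ ◅◅ r = step e (r′ ◅◅ r)

  Reach-map : ∀ {A B : Graph N} → (∀ a b → E A a b ≡ true → E B a b ≡ true) →
              ∀ {u v} → Reach A u v → Reach B u v
  Reach-map A⊆B here       = here
  Reach-map A⊆B (step e r) = step (A⊆B _ _ e) (Reach-map A⊆B r)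

  Reach-invariant : ∀ {G : Graph N} (P : Fin N → Set) → (∀ a b → E G a b ≡ true → P a → P b) →
                    ∀ {u v} → Reach G u v → P u → P v
  Reach-invariant P closed here       pu = pu
  Reach-invariant P closed (step e r) pu = Reach-invariant P closed r (closed _ _ e pu)

  data Path (G : Graph N) (ks : List (Fin N)) : Fin N → Fin N → Set where
    edge : ∀ {u v}   → E G u v ≡ true → Path G ks u v
    via  : ∀ {u w v} → E G u w ≡ true → w ∈ ks → Path G ks w v → Path G ks u v

  module _ {G : Graph N} where

    Path-weaken : ∀ {k ks u v} → Path G ks u v → Path G (k ∷ ks) u v
    Path-weaken (edge e)      = edge e
    Path-weaken (via e w∈ p) = via e (there w∈) (Path-weaken p)

    Path-join : ∀ {ks u k v} → Path G ks u k → k ∈ ks → Path G ks k v → Path G ks u v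
    Path-join (edge e)      k∈ q = via e k∈ q
    Path-join (via e w∈ p) k∈ q = via e w∈ (Path-join p k∈ q)

    Path-split : ∀ {k ks u v} → Path G (k ∷ ks) u v → Path G ks u v ⊎ (Path G ks u k × Path G ks k v)
    Path-split (edge e) = inj₁ (edge e)
    Path-split (via e (here refl) p) with Path-split p
    ... | inj₁ p′       = inj₂ (edge e , p′)
    ... | inj₂ (_ , p₂) = inj₂ (edge e , p₂)
    Path-split (via e (there w∈) p) with Path-split p
    ... | inj₁ p′        = inj₁ (via e w∈ p′)
    ... | inj₂ (p₁ , p₂) = inj₂ (via e w∈ p₁ , p₂)

    -- Floyd–Warshall: a path with inner vertices in k ∷ ks avoids k or splits at k.
    Path? : ∀ ks u v → Dec (Path G ks u v)
    Path? []       u v = map′ edge (λ { (edge e) → e ; (via _ () _) }) (E G u v ≟ᵇ true)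
    Path? (k ∷ ks) u v = map′ [ Path-weaken , through-k ]′ Path-split
                              (Path? ks u v ⊎-dec (Path? ks u k ×-dec Path? ks k v))
      where
      through-k : Path G ks u k × Path G ks k v → Path G (k ∷ ks) u v
      through-k (p , q) = Path-join (Path-weaken p) (here refl) (Path-weaken q)

    Path⇒Reach : ∀ {ks u v} → Path G ks u v → Reach G u v
    Path⇒Reach (edge e)     = step e here
    Path⇒Reach (via e _ p) = step e (Path⇒Reach p)

    Reach⇒Path : ∀ {u v} → Reach G u v → u ≡ v ⊎ Path G (allFin N) u v
    Reach⇒Path here = inj₁ refl
    Reach⇒Path (step e r) with Reach⇒Path r
    ... | inj₁ refl = inj₂ (edge e)
    ... | inj₂ p    = inj₂ (via e (∈-allFin _) p)

    Reach? : ∀ u v → Dec (Reach G u v)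
    Reach? u v = map′ [ (λ { refl → here }) , Path⇒Reach ]′ Reach⇒Path (u ≟ v ⊎-dec Path? (allFin N) u v)

deleteVerts-vertex⁻ : ∀ {N} (G : Graph N) S {t} → V (deleteVerts G S) t ≡ true → V G t ≡ true × S t ≡ false
deleteVerts-vertex⁻ G S t∈ = Product.map₂ not-true⁻ (∧-true⁻ t∈)

module _ {N : ℕ} (K : Graph N) (S : Fin N → Bool) where

  deleteVerts-edge⁻ : ∀ {a b} → E (deleteVerts K S) a b ≡ true → E K a b ≡ true × S a ≡ false × S b ≡ false
  deleteVerts-edge⁻ e with ∧-true⁻ e
  ... | eK , rest with ∧-true⁻ rest
  ... | a∉S , b∉S = eK , not-true⁻ a∉S , not-true⁻ b∉S

  deleteVerts-edge⁺ : ∀ {a b} → E K a b ≡ true → S a ≡ false → S b ≡ false → E (deleteVerts K S) a b ≡ true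
  deleteVerts-edge⁺ eK a∉S b∉S = ∧-true⁺ eK (∧-true⁺ (cong not a∉S) (cong not b∉S))

  Reach-deleteVerts-∉ : ∀ {u v} → Reach (deleteVerts K S) u v → S u ≡ false → S v ≡ false
  Reach-deleteVerts-∉ = Reach-invariant (λ t → S t ≡ false) (λ a b e _ → proj₂ (proj₂ (deleteVerts-edge⁻ e)))

module _ {N : ℕ} {K : Graph N} (simple : IsSimple K) where

  open IsSimple simple renaming (sym to adj-sym; irrefl to adj-irrefl)

  endpointʳ : ∀ {a b} → E K a b ≡ true → V K b ≡ true
  endpointʳ {a} {b} e = endpoints b a (trans (adj-sym b a) e)

  Reach-deleteVerts-antimono : ∀ {A S : Fin N → Bool} → (∀ t → V K t ≡ true → S t ≡ true → A t ≡ true) →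
                               ∀ {u v} → Reach (deleteVerts K A) u v → Reach (deleteVerts K S) u v
  Reach-deleteVerts-antimono {A} {S} S⊆A = Reach-map shrink
    where
    outside : ∀ {t} → V K t ≡ true → A t ≡ false → S t ≡ false
    outside Vt t∉A = ¬-not λ t∈S → ≡true⇒≢false (S⊆A _ Vt t∈S) t∉A
    shrink : ∀ a b → E (deleteVerts K A) a b ≡ true → E (deleteVerts K S) a b ≡ true
    shrink a b e with deleteVerts-edge⁻ K A e
    ... | eK , a∉A , b∉A = deleteVerts-edge⁺ K S eK (outside (endpoints a b eK) a∉A) (outside (endpointʳ eK) b∉A)

-- Two-cuts of internally 3-connected graphs

Iso⇒length≤count : ∀ {M N} {G : Graph M} {H : Graph N} → Iso G H →
                   ∀ {xs} → Unique xs → All (λ t → V G t ≡ true) xs → length xs ≤ count (V H)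
Iso⇒length≤count {G = G} {H} (f , preserves , injective , _) {xs} unique inG =
  ≤-trans (≤-reflexive (sym (length-map f xs)))
          (length≤count (map-unique unique inG) (All-map⁺ (All.map (preserves _) inG)))
  where
  map-unique : ∀ {ys} → Unique ys → All (λ t → V G t ≡ true) ys → Unique (map f ys)
  map-unique []                  []          = []
  map-unique (y∉ys ∷ unique) (Vy ∷ inG) =
      All-map⁺ (All.zipWith (λ (y≢t , Vt) fy≡ft → y≢t (injective _ _ Vy Vt fy≡ft)) (y∉ys , inG))
    ∷ map-unique unique inG

∨-∧-not-cover : ∀ v c s → (c ≡ true → v ≡ true) → (s ≡ true → v ≡ true) →
                v ≡ (c ∨ s) ∨ (v ∧ not c)
∨-∧-not-cover true  true  _     _   _   = refl
∨-∧-not-cover true  false true  _   _   = refl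
∨-∧-not-cover true  false false _   _   = refl
∨-∧-not-cover false true  _     c⇒v _   = case c⇒v refl of λ ()
∨-∧-not-cover false false true  _   s⇒v = case s⇒v refl of λ ()
∨-∧-not-cover false false false _   _   = refl

∨-∧-not-meet : ∀ c s v → (c ≡ true → s ≡ false) → (s ≡ true → v ≡ true) →
               (c ∨ s) ∧ (v ∧ not c) ≡ s
∨-∧-not-meet true  s     true  c⇒¬s _   = sym (c⇒¬s refl)
∨-∧-not-meet true  s     false c⇒¬s _   = sym (c⇒¬s refl)
∨-∧-not-meet false true  v     _    s⇒v = cong (_∧ true) (s⇒v refl)
∨-∧-not-meet false false v     _    _   = refl

∧-∨-split : ∀ e a b → e ≡ (e ∧ (a ∨ b)) ∨ (e ∧ (not a ∧ not b))
∧-∨-split false _     _     = refl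
∧-∨-split true  true  _     = refl
∧-∨-split true  false true  = refl
∧-∨-split true  false false = refl

∧-∨-split-disjoint : ∀ e a b → e ∧ (a ∨ b) ≡ true → e ∧ (not a ∧ not b) ≡ false
∧-∨-split-disjoint true true  _    _ = refl
∧-∨-split-disjoint true false true _ = refl

NbrsWithin : ∀ {N} → Graph N → Fin N → Fin N → Fin N → Set
NbrsWithin K w s₁ s₂ = ∀ z → E K w z ≡ true → z ≡ s₁ ⊎ z ≡ s₂

no-four-vertices-in-P3 : ∀ {N} {G : Graph N} → Iso G P3 → ∀ {a b c d} → Unique (a ∷ b ∷ c ∷ d ∷ []) →
                         All (λ t → V G t ≡ true) (a ∷ b ∷ c ∷ d ∷ []) → ⊥
no-four-vertices-in-P3 iso unique inG with Iso⇒length≤count {H = P3} iso unique inG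
... | s≤s (s≤s (s≤s ()))

module TwoCut {N : ℕ} {K : Graph N} (simple : IsSimple K) {s₁ s₂ u v : Fin N} (s₁≢s₂ : s₁ ≢ s₂)
  (Vs₁ : V K s₁ ≡ true) (Vs₂ : V K s₂ ≡ true) (Vu : V K u ≡ true) (Vv : V K v ≡ true)
  (u∉S : pair s₁ s₂ u ≡ false) (v∉S : pair s₁ s₂ v ≡ false)
  (u↛v : ¬ Reach (deleteVerts K (pair s₁ s₂)) u v) where

  open IsSimple simple renaming (sym to adj-sym; irrefl to adj-irrefl)

  S : Fin N → Bool
  S = pair s₁ s₂

  C : Fin N → Bool
  C t = ⌊ Reach? {G = deleteVerts K S} u t ⌋

  C-sound : ∀ {t} → C t ≡ true → Reach (deleteVerts K S) u t
  C-sound {t} ct with Reach? {G = deleteVerts K S} u t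
  ... | yes r = r

  C-complete : ∀ {t} → Reach (deleteVerts K S) u t → C t ≡ true
  C-complete {t} r with Reach? {G = deleteVerts K S} u t
  ... | yes _ = refl
  ... | no ¬r = contradiction r ¬r

  C-avoids-S : ∀ {t} → C t ≡ true → S t ≡ false
  C-avoids-S ct = Reach-deleteVerts-∉ K S (C-sound ct) u∉S

  C⊆V : ∀ {t} → C t ≡ true → V K t ≡ true
  C⊆V ct = Reach-invariant (λ t → V K t ≡ true) (λ a b e _ → endpointʳ simple (proj₁ (deleteVerts-edge⁻ K S e)))
                           (C-sound ct) Vu

  S⊆V : ∀ {t} → S t ≡ true → V K t ≡ true
  S⊆V {t} st with pair-true⁻ s₁ s₂ {t} st
  ... | inj₁ refl = Vs₁
  ... | inj₂ refl = Vs₂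

  C-closed : ∀ {z w} → C z ≡ true → E K w z ≡ true → S w ≡ false → C w ≡ true
  C-closed {z} {w} cz e w∉S =
    C-complete (C-sound cz ◅◅ step (deleteVerts-edge⁺ K S (trans (adj-sym z w) e) (C-avoids-S cz) w∉S) here)

  Cu : C u ≡ true
  Cu = C-complete here

  Cv : C v ≡ false
  Cv = ¬-not λ cv → u↛v (C-sound cv)

  S-avoids-C : ∀ {t} → S t ≡ true → C t ≡ false
  S-avoids-C st = ¬-not λ ct → ≡true⇒≢false st (C-avoids-S ct)

  ∉S⇒≢ : ∀ {t s} → S t ≡ false → S s ≡ true → t ≢ s
  ∉S⇒≢ t∉S s∈S refl = ≡true⇒≢false s∈S t∉S

  S₁ : S s₁ ≡ true
  S₁ = pair-true⁺ s₁ s₂ (inj₁ refl)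

  S₂ : S s₂ ≡ true
  S₂ = pair-true⁺ s₁ s₂ (inj₂ refl)

  side₁ : Graph N
  side₁ = mkGraph (λ t → C t ∨ S t) (λ w z → E K w z ∧ (C w ∨ C z))

  side₂ : Graph N
  side₂ = mkGraph (λ t → V K t ∧ not (C t)) (λ w z → E K w z ∧ (not (C w) ∧ not (C z)))

  side₁-endpoints : ∀ w z → E side₁ w z ≡ true → V side₁ w ≡ true
  side₁-endpoints w z e = [ ∨-trueˡ (S w) , from-z ]′ (∨-true⁻ (proj₂ (∧-true⁻ {E K w z} e)))
    where
    from-z : C z ≡ true → C w ∨ S w ≡ true
    from-z cz with S w in sw
    ... | true  = ∨-trueʳ (C w) refl
    ... | false = ∨-trueˡ false (C-closed cz (proj₁ (∧-true⁻ e)) sw)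

  simple₁ : IsSimple side₁
  simple₁ = record
    { sym       = λ w z → cong₂ _∧_ (adj-sym w z) (∨-comm (C w) (C z))
    ; irrefl    = λ w → cong (_∧ (C w ∨ C w)) (adj-irrefl w)
    ; endpoints = side₁-endpoints }

  simple₂ : IsSimple side₂
  simple₂ = record
    { sym       = λ w z → cong₂ _∧_ (adj-sym w z) (∧-comm (not (C w)) (not (C z)))
    ; irrefl    = λ w → cong (_∧ (not (C w) ∧ not (C w))) (adj-irrefl w)
    ; endpoints = λ w z e → ∧-true⁺ (endpoints w z (proj₁ (∧-true⁻ e)))
                                    (proj₁ (∧-true⁻ (proj₂ (∧-true⁻ {E K w z} e)))) }

  in₂ : ∀ {t} → V K t ≡ true → C t ≡ false → V side₂ t ≡ true
  in₂ Vt ct = ∧-true⁺ Vt (cong not ct)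

  separation : TwoSeparation K side₁ side₂
  separation =
      simple₁ , simple₂
    , ((λ t ct∨st → [ C⊆V , S⊆V ]′ (∨-true⁻ ct∨st)) , λ _ _ e → proj₁ (∧-true⁻ e))
    , ((λ _ e → proj₁ (∧-true⁻ e)) , λ _ _ e → proj₁ (∧-true⁻ e))
    , (λ w z → ∧-∨-split-disjoint (E K w z) (C w) (C z))
    , (λ t → ∨-∧-not-cover (V K t) (C t) (S t) C⊆V S⊆V)
    , (λ w z → ∧-∨-split (E K w z) (C w) (C z))
    , trans (count-cong (λ t → ∨-∧-not-meet (C t) (S t) (V K t) C-avoids-S S⊆V)) (count-pair s₁≢s₂)
    , length≤count (distinct₃ (∉S⇒≢ u∉S S₁) (∉S⇒≢ u∉S S₂) s₁≢s₂)
                   (∨-trueˡ (S u) Cu ∷ ∨-trueʳ (C s₁) S₁ ∷ ∨-trueʳ (C s₂) S₂ ∷ [])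
    , length≤count (distinct₃ (∉S⇒≢ v∉S S₁) (∉S⇒≢ v∉S S₂) s₁≢s₂)
                   (in₂ Vv Cv ∷ in₂ Vs₁ (S-avoids-C S₁) ∷ in₂ Vs₂ (S-avoids-C S₂) ∷ [])

  side₁-P3 : Iso side₁ P3 → NbrsWithin K u s₁ s₂
  side₁-P3 iso z e = pair-true⁻ s₁ s₂ (¬-not λ z∉S → no-four-vertices-in-P3 iso
    (distinct₄ u≢z (∉S⇒≢ u∉S S₁) (∉S⇒≢ u∉S S₂) (∉S⇒≢ z∉S S₁) (∉S⇒≢ z∉S S₂) s₁≢s₂)
    (∨-trueˡ (S u) Cu ∷ ∨-trueˡ (S z) (C-closed Cu (trans (adj-sym z u) e) z∉S)
                      ∷ ∨-trueʳ (C s₁) S₁ ∷ ∨-trueʳ (C s₂) S₂ ∷ []))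
    where
    u≢z : u ≢ z
    u≢z refl = ≡true⇒≢false e (adj-irrefl u)

  side₂-P3 : Iso side₂ P3 → NbrsWithin K v s₁ s₂
  side₂-P3 iso z e = pair-true⁻ s₁ s₂ (¬-not λ z∉S → no-four-vertices-in-P3 iso
    (distinct₄ v≢z (∉S⇒≢ v∉S S₁) (∉S⇒≢ v∉S S₂) (∉S⇒≢ z∉S S₁) (∉S⇒≢ z∉S S₂) s₁≢s₂)
    (in₂ Vv Cv ∷ in₂ (endpointʳ simple e) Cz ∷ in₂ Vs₁ (S-avoids-C S₁) ∷ in₂ Vs₂ (S-avoids-C S₂) ∷ []))
    where
    v≢z : v ≢ z
    v≢z refl = ≡true⇒≢false e (adj-irrefl v)
    Cz : C z ≡ false
    Cz = ¬-not λ cz → ≡true⇒≢false (C-closed cz e v∉S) Cv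

separated⇒NbrsWithin : ∀ {N} {K : Graph N} → IsSimple K → Internally3Connected K →
  ∀ {s₁ s₂ u v} → s₁ ≢ s₂ → V K s₁ ≡ true → V K s₂ ≡ true → V K u ≡ true → V K v ≡ true →
  pair s₁ s₂ u ≡ false → pair s₁ s₂ v ≡ false → ¬ Reach (deleteVerts K (pair s₁ s₂)) u v →
  NbrsWithin K u s₁ s₂ ⊎ NbrsWithin K v s₁ s₂
separated⇒NbrsWithin simple (_ , _ , P3-side) s₁≢s₂ Vs₁ Vs₂ Vu Vv u∉S v∉S u↛v =
  Sum.map side₁-P3 side₂-P3 (P3-side side₁ side₂ separation)
  where open TwoCut simple s₁≢s₂ Vs₁ Vs₂ Vu Vv u∉S v∉S u↛v

Reach-or-low-degree : ∀ {N} {K : Graph N} → IsSimple K → Internally3Connected K →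
  ∀ S → count S < 3 → ∀ {u v} → V K u ≡ true → V K v ≡ true → S u ≡ false → S v ≡ false →
  Reach (deleteVerts K S) u v ⊎ ∃₂ λ s₁ s₂ → s₁ ≢ s₂ × (NbrsWithin K u s₁ s₂ ⊎ NbrsWithin K v s₁ s₂)
Reach-or-low-degree {N} {K} simple i3@((_ , connected) , _) S S<3 {u} {v} Vu Vv u∉S v∉S =
  by-size (2 ≤? count S′)
  where
  S′ : Fin N → Bool
  S′ t = S t ∧ V K t

  S′≤S : count S′ ≤ count S
  S′≤S = count-mono {p = S′} (λ t st′ → proj₁ (∧-true⁻ st′))

  u∉S′ : S′ u ≡ false
  u∉S′ = cong (_∧ V K u) u∉S

  v∉S′ : S′ v ≡ false
  v∉S′ = cong (_∧ V K v) v∉S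

  Outcome : Set
  Outcome = Reach (deleteVerts K S) u v
          ⊎ ∃₂ λ s₁ s₂ → s₁ ≢ s₂ × (NbrsWithin K u s₁ s₂ ⊎ NbrsWithin K v s₁ s₂)

  by-size : Dec (2 ≤ count S′) → Outcome
  by-size (no S′<2) = inj₁ (Reach-deleteVerts-antimono simple (λ t Vt st → ∧-true⁺ st Vt)
    (connected S′ (≰⇒> S′<2) u v (∧-true⁺ Vu (cong not u∉S′)) (∧-true⁺ Vv (cong not v∉S′))))
  by-size (yes 2≤S′) with count≡2⇒pair (≤-antisym (≤-pred (≤-trans (s≤s S′≤S) S<3)) 2≤S′)
  ... | s₁ , s₂ , s₁≢s₂ , S′≗pair with Reach? {G = deleteVerts K (pair s₁ s₂)} u v
  ...   | yes r   = inj₁ (Reach-deleteVerts-antimono simple (λ t Vt st → trans (sym (S′≗pair t)) (∧-true⁺ st Vt)) r)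
  ...   | no u↛v = inj₂ (s₁ , s₂ , s₁≢s₂ ,
      separated⇒NbrsWithin simple i3 s₁≢s₂ (in-V (inj₁ refl)) (in-V (inj₂ refl)) Vu Vv
                           (trans (sym (S′≗pair u)) u∉S′) (trans (sym (S′≗pair v)) v∉S′) u↛v)
    where
    in-V : ∀ {t} → t ≡ s₁ ⊎ t ≡ s₂ → V K t ≡ true
    in-V {t} t∈ = proj₂ (∧-true⁻ {S t} (trans (S′≗pair t) (pair-true⁺ s₁ s₂ t∈)))

-- Rerouting walks around deleted vertices

-- The three kinds of enhanced deletion are of this form, with D = {x, y}, {z} and ∅.
record Bypass {N : ℕ} (K H : Graph N) (D : Fin N → Bool) : Set where
  field
    vertices  : ∀ t → V H t ≡ true → V K t ≡ true × D t ≡ false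
    edges     : ∀ a b → E K a b ≡ true → D a ≡ false → D b ≡ false → E H a b ≡ true
    exits     : ∀ w b → D w ≡ true → E K w b ≡ true → D b ≡ false
    shortcuts : ∀ a w b → D w ≡ true → E K a w ≡ true → E K w b ≡ true → a ≡ b ⊎ E H a b ≡ true

  lift : ∀ {T u v} → Reach (deleteVerts K T) u v → D u ≡ false → D v ≡ false → Reach (deleteVerts H T) u v
  lift here _ _ = here
  lift {T} (step {w = w} e r) Du Dv with deleteVerts-edge⁻ K T e | D w in Dw
  ... | eK , u∉T , w∉T | false = step (deleteVerts-edge⁺ H T (edges _ _ eK Du Dw) u∉T w∉T) (lift r Dw Dv)
  ... | eK , u∉T , _   | true with r
  ...   | here        = contradiction Dv (≡true⇒≢false Dw)
  ...   | step e′ r′ with deleteVerts-edge⁻ K T e′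
  ...     | eK′ , _ , w′∉T with shortcuts _ _ _ Dw eK eK′
  ...       | inj₁ refl = lift r′ Du Dv
  ...       | inj₂ eH   = step (deleteVerts-edge⁺ H T eH u∉T w′∉T) (lift r′ (exits _ _ Dw eK′) Dv)

bypass-ThreeConnected : ∀ {N} {K H : Graph N} {D} → IsSimple K → Internally3Connected K → Bypass K H D →
  (∀ w s₁ s₂ → V K w ≡ true → s₁ ≢ s₂ → NbrsWithin K w s₁ s₂ → D w ≡ true) →
  3 < count (V H) → ThreeConnected H
bypass-ThreeConnected {K = K} {H} {D} simple i3 bypass low-degree⇒D big = big , connected
  where
  open Bypass bypass

  not-low-degree : ∀ {w s₁ s₂} → V H w ≡ true → s₁ ≢ s₂ → ¬ NbrsWithin K w s₁ s₂
  not-low-degree Hw s₁≢s₂ within with vertices _ Hw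
  ... | Vw , Dw = ≡true⇒≢false (low-degree⇒D _ _ _ Vw s₁≢s₂ within) Dw

  connected : ∀ S → count S < 3 → Connected (deleteVerts H S)
  connected S S<3 u v u∈ v∈ with deleteVerts-vertex⁻ H S u∈ | deleteVerts-vertex⁻ H S v∈
  ... | Hu , u∉S | Hv , v∉S with vertices u Hu | vertices v Hv
  ... | Vu , Du | Vv , Dv with Reach-or-low-degree simple i3 S S<3 Vu Vv u∉S v∉S
  ...   | inj₁ r = lift r Du Dv
  ...   | inj₂ (_ , _ , s₁≢s₂ , inj₁ u-low) = ⊥-elim (not-low-degree Hu s₁≢s₂ u-low)
  ...   | inj₂ (_ , _ , s₁≢s₂ , inj₂ v-low) = ⊥-elim (not-low-degree Hv s₁≢s₂ v-low)

ThreeConnected-SameGraph : ∀ {N} {H H₀ : Graph N} → SameGraph H H₀ → ThreeConnected H₀ → ThreeConnected H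
ThreeConnected-SameGraph {H₀ = H₀} (V≡ , E≡) (big , connected) =
  subst (3 <_) (sym (count-cong V≡)) big , λ S S<3 u v u∈ v∈ →
    Reach-map {A = deleteVerts H₀ S} (λ a b e → trans (cong (_∧ _) (E≡ a b)) e)
              (connected S S<3 u v (trans (cong (_∧ _) (sym (V≡ u))) u∈) (trans (cong (_∧ _) (sym (V≡ v))) v∈))

-- Deleting an edge of a triangle-free 3-connected graph

nbr-outside : ∀ {N} {G : Graph N} → IsSimple G → ThreeConnected G →
              ∀ {w} → V G w ≡ true → ∀ s₁ s₂ → ∃[ z ] (E G w z ≡ true × z ≢ s₁ × z ≢ s₂)
nbr-outside {N} {G} simple (big , connected) {w} Vw s₁ s₂ with ∃-outside {p = V G} {xs = w ∷ s₁ ∷ s₂ ∷ []} big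
... | t , Vt , t∉ = first-step (connected T T<3 w t (∧-true⁺ Vw (cong not Tw)) (∧-true⁺ Vt (cong not Tt)))
  where
  -- w is kept out of the cut so that it survives in G − T.
  T : Fin N → Bool
  T = pair s₁ s₂ ∖ w

  T<3 : count T < 3
  T<3 = s≤s (count≤length {p = T} {xs = s₁ ∷ s₂ ∷ []} cover)
    where
    cover : ∀ t → T t ≡ true → t ∈ s₁ ∷ s₂ ∷ []
    cover t Tt with pair-true⁻ s₁ s₂ (proj₂ (∧-true⁻ Tt))
    ... | inj₁ t≡s₁ = here t≡s₁
    ... | inj₂ t≡s₂ = there (here t≡s₂)

  Tw : T w ≡ false
  Tw = cong (λ b → not b ∧ pair s₁ s₂ w) (single-self w)

  Tt : T t ≡ false
  Tt = trans (cong (not (single w t) ∧_) (pair-false (t∉ ∘ there ∘ here) (t∉ ∘ there ∘ there ∘ here)))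
             (∧-zeroʳ _)

  first-step : Reach (deleteVerts G T) w t → ∃[ z ] (E G w z ≡ true × z ≢ s₁ × z ≢ s₂)
  first-step here = contradiction (here refl) t∉
  first-step (step {w = z} e _) with deleteVerts-edge⁻ G T e
  ... | eG , _ , z∉T = z , eG , (λ { refl → ≢pair (inj₁ refl) }) , (λ { refl → ≢pair (inj₂ refl) })
    where
    z≢w : z ≢ w
    z≢w refl = ≡true⇒≢false eG (IsSimple.irrefl simple w)
    ≢pair : ¬ (z ≡ s₁ ⊎ z ≡ s₂)
    ≢pair z∈ = ≡true⇒≢false (pair-true⁺ s₁ s₂ z∈)
                            (trans (cong (λ b → not b ∧ pair s₁ s₂ z) (sym (single-false z≢w))) z∉T)

module _ {N : ℕ} where

  Ends : Fin N → Fin N → Fin N → Fin N → Set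
  Ends x y w w′ = (w ≡ x × w′ ≡ y) ⊎ (w ≡ y × w′ ≡ x)

  Ends-partner : ∀ {x y w w′ w″} → Ends x y w w′ → Ends x y w w″ → w′ ≡ w″
  Ends-partner (inj₁ (refl , refl)) (inj₁ (_ , refl))    = refl
  Ends-partner (inj₁ (refl , refl)) (inj₂ (refl , refl)) = refl
  Ends-partner (inj₂ (refl , refl)) (inj₁ (refl , refl)) = refl
  Ends-partner (inj₂ (refl , refl)) (inj₂ (_ , refl))    = refl

  Ends-other : ∀ {x y z z′ w w′} → Ends x y z z′ → Ends x y w w′ → w ≢ z → w ≡ z′
  Ends-other (inj₁ (refl , refl)) (inj₁ (refl , _)) w≢z = contradiction refl w≢z
  Ends-other (inj₁ (refl , refl)) (inj₂ (refl , _)) _   = refl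
  Ends-other (inj₂ (refl , refl)) (inj₁ (refl , _)) _   = refl
  Ends-other (inj₂ (refl , refl)) (inj₂ (refl , _)) w≢z = contradiction refl w≢z

  isPair-true⁻ : ∀ {x y u v : Fin N} → isPair x y u v ≡ true → Ends x y u v
  isPair-true⁻ p with ∨-true⁻ p
  ... | inj₁ q = inj₁ (Product.map single-true⁻ single-true⁻ (∧-true⁻ q))
  ... | inj₂ q = inj₂ (Product.map single-true⁻ single-true⁻ (∧-true⁻ q))

  isPair-true⁺ : ∀ x y {u v : Fin N} → Ends x y u v → isPair x y u v ≡ true
  isPair-true⁺ x y (inj₁ (refl , refl)) = ∨-trueˡ _ (∧-true⁺ (single-self x) (single-self y))
  isPair-true⁺ x y (inj₂ (refl , refl)) = ∨-trueʳ (single x y ∧ single y x) (∧-true⁺ (single-self y) (single-self x))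

  isPair-sym : ∀ (x y u v : Fin N) → isPair x y u v ≡ isPair x y v u
  isPair-sym x y u v = trans (∨-comm (single x u ∧ single y v) _)
                             (cong₂ _∨_ (∧-comm (single y u) (single x v)) (∧-comm (single x u) (single y v)))

module DeleteEdge {N : ℕ} (G : Graph N) (x y : Fin N) where

  deleteEdge-⊆ : ∀ {u v} → E (deleteEdge G x y) u v ≡ true → E G u v ≡ true
  deleteEdge-⊆ e = proj₁ (∧-true⁻ e)

  deleteEdge-edge : ∀ {u v} → E G u v ≡ true → E (deleteEdge G x y) u v ≡ true ⊎ Ends x y u v
  deleteEdge-edge {u} {v} e with isPair x y u v in p
  ... | true  = inj₂ (isPair-true⁻ p)
  ... | false = inj₁ (∧-true⁺ e refl)

  deleteEdge-removes : ∀ {u v} → Ends x y u v → E (deleteEdge G x y) u v ≡ false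
  deleteEdge-removes {u} {v} ends = trans (cong (λ b → E G u v ∧ not b) (isPair-true⁺ x y ends)) (∧-zeroʳ _)

  deleteEdge-simple : IsSimple G → IsSimple (deleteEdge G x y)
  deleteEdge-simple simple = record
    { sym       = λ u v → cong₂ (λ e p → e ∧ not p) (IsSimple.sym simple u v) (isPair-sym x y u v)
    ; irrefl    = λ u → cong (λ e → e ∧ not (isPair x y u u)) (IsSimple.irrefl simple u)
    ; endpoints = λ u v e → IsSimple.endpoints simple u v (deleteEdge-⊆ e) }

NbhdIs-shortcut : ∀ {N} {K : Graph N} → IsSimple K → ∀ {w a b t₁ t₂} → NbhdIs K w a b →
                  E K t₁ w ≡ true → E K w t₂ ≡ true → t₁ ≡ t₂ ⊎ isPair a b t₁ t₂ ≡ true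
NbhdIs-shortcut simple {a = a} {b} (_ , nbhd) e₁ e₂
  with Equivalence.to (nbhd _) (trans (IsSimple.sym simple _ _) e₁) | Equivalence.to (nbhd _) e₂
... | inj₁ refl | inj₁ refl = inj₁ refl
... | inj₂ refl | inj₂ refl = inj₁ refl
... | inj₁ refl | inj₂ refl = inj₂ (isPair-true⁺ a b (inj₁ (refl , refl)))
... | inj₂ refl | inj₁ refl = inj₂ (isPair-true⁺ a b (inj₂ (refl , refl)))

adjˡ : ∀ {N} {K : Graph N} {w a b} → NbhdIs K w a b → E K w a ≡ true
adjˡ (_ , nbhd) = Equivalence.from (nbhd _) (inj₁ refl)

adjʳ : ∀ {N} {K : Graph N} {w a b} → NbhdIs K w a b → E K w b ≡ true
adjʳ (_ , nbhd) = Equivalence.from (nbhd _) (inj₂ refl)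

module EdgeDeletion {N : ℕ} {G : Graph N} {x y : Fin N} (simple : IsSimple G) (triangle-free : TriangleFree G)
  (three : ThreeConnected G) (exy : E G x y ≡ true) (i3 : Internally3Connected (deleteEdge G x y)) where

  open IsSimple simple renaming (sym to adj-sym; irrefl to adj-irrefl)
  open DeleteEdge G x y

  K : Graph N
  K = deleteEdge G x y

  simpleK : IsSimple K
  simpleK = deleteEdge-simple simple

  triangle : ∀ {a b c} → E G a b ≡ true → E G b c ≡ true → E G a c ≡ true → ⊥
  triangle e₁ e₂ e₃ = triangle-free (_ , _ , _ , e₁ , e₂ , e₃)

  G-irrefl : ∀ {w t} → E G w t ≡ true → t ≢ w
  G-irrefl {w} e refl = ≡true⇒≢false e (adj-irrefl w)

  K-irrefl : ∀ {w t} → E K w t ≡ true → t ≢ w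
  K-irrefl e = G-irrefl (deleteEdge-⊆ e)

  Ends-edge : ∀ {w w′} → Ends x y w w′ → E G w w′ ≡ true
  Ends-edge (inj₁ (refl , refl)) = exy
  Ends-edge (inj₂ (refl , refl)) = trans (adj-sym y x) exy

  end-adjacent : ∀ {w w′ s s′} → V G w ≡ true → Ends x y w w′ → NbrsWithin K w s s′ → E K w s ≡ true
  end-adjacent {w} {w′} {s} {s′} Vw ends within with nbr-outside simple three Vw s′ w′
  ... | z , e , z≢s′ , z≢w′ with deleteEdge-edge e
  ...   | inj₂ ends′ = ⊥-elim (z≢w′ (sym (Ends-partner ends ends′)))
  ...   | inj₁ eK with within z eK
  ...     | inj₁ refl = eK
  ...     | inj₂ z≡s′ = ⊥-elim (z≢s′ z≡s′)

  low-degree⇒end : ∀ {w s₁ s₂} → V G w ≡ true → NbrsWithin K w s₁ s₂ → ∃[ w′ ] Ends x y w w′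
  low-degree⇒end {w} {s₁} {s₂} Vw within with nbr-outside simple three Vw s₁ s₂
  ... | z , e , z≢s₁ , z≢s₂ with deleteEdge-edge e
  ...   | inj₁ eK   = ⊥-elim ([ z≢s₁ , z≢s₂ ]′ (within z eK))
  ...   | inj₂ ends = z , ends

  low-degree⇒TwoNonadjNbrs : ∀ {w s₁ s₂} → V G w ≡ true → s₁ ≢ s₂ → NbrsWithin K w s₁ s₂ →
                             TwoNonadjNbrs K w
  low-degree⇒TwoNonadjNbrs {w} {s₁} {s₂} Vw s₁≢s₂ within =
    s₁ , s₂ , (s₁≢s₂ , λ t → mk⇔ (within t) nbr) , nonadjacent
    where
    ends : Ends x y w _
    ends = proj₂ (low-degree⇒end Vw within)

    nbr : ∀ {t} → t ≡ s₁ ⊎ t ≡ s₂ → E K w t ≡ true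
    nbr (inj₁ refl) = end-adjacent Vw ends within
    nbr (inj₂ refl) = end-adjacent Vw ends (λ t e → Sum.swap (within t e))

    nonadjacent : E K s₁ s₂ ≡ false
    nonadjacent = ¬-not λ e →
      triangle (deleteEdge-⊆ (nbr (inj₁ refl))) (deleteEdge-⊆ e) (deleteEdge-⊆ (nbr (inj₂ refl)))

  end-nbr-outside : ∀ {w t} → pair x y w ≡ true → E K w t ≡ true → pair x y t ≡ false
  end-nbr-outside {w} {t} Dw e with pair-true⁻ x y {w} Dw
  ... | inj₁ refl = pair-false (K-irrefl e) (λ { refl → ≡true⇒≢false e (deleteEdge-removes (inj₁ (refl , refl))) })
  ... | inj₂ refl = pair-false (λ { refl → ≡true⇒≢false e (deleteEdge-removes (inj₂ (refl , refl))) }) (K-irrefl e)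

  caseI-ThreeConnected : ∀ {a b c d} → NbhdIs K x a b → NbhdIs K y c d → a ≢ c → a ≢ d → b ≢ c → b ≢ d →
                         ThreeConnected (addEdge (addEdge (deleteVerts G (pair x y)) a b) c d)
  caseI-ThreeConnected {a} {b} {c} {d} nbx nby a≢c a≢d b≢c b≢d =
    bypass-ThreeConnected simpleK i3 bypass low-degree-deleted
      (length≤count (distinct₄ (proj₁ nbx) a≢c a≢d b≢c b≢d (proj₁ nby))
                    (kept x∈ (adjˡ {K = K} nbx) ∷ kept x∈ (adjʳ {K = K} nbx)
                     ∷ kept y∈ (adjˡ {K = K} nby) ∷ kept y∈ (adjʳ {K = K} nby) ∷ []))
    where
    H₀ : Graph N
    H₀ = addEdge (addEdge (deleteVerts G (pair x y)) a b) c d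

    x∈ : pair x y x ≡ true
    x∈ = pair-true⁺ x y (inj₁ refl)

    y∈ : pair x y y ≡ true
    y∈ = pair-true⁺ x y (inj₂ refl)

    kept : ∀ {w t} → pair x y w ≡ true → E K w t ≡ true → V G t ∧ not (pair x y t) ≡ true
    kept Dw e = ∧-true⁺ (endpointʳ simpleK e) (cong not (end-nbr-outside Dw e))

    bypass : Bypass K H₀ (pair x y)
    bypass = record
      { vertices  = λ t → deleteVerts-vertex⁻ G (pair x y)
      ; edges     = λ u v e Du Dv → ∨-trueˡ (isPair c d u v) (∨-trueˡ (isPair a b u v)
                                      (deleteVerts-edge⁺ G (pair x y) (deleteEdge-⊆ e) Du Dv))
      ; exits     = λ _ _ → end-nbr-outside
      ; shortcuts = shortcuts }
      where
      shortcuts : ∀ t₁ w t₂ → pair x y w ≡ true → E K t₁ w ≡ true → E K w t₂ ≡ true →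
                  t₁ ≡ t₂ ⊎ E H₀ t₁ t₂ ≡ true
      shortcuts t₁ w t₂ Dw e₁ e₂ with pair-true⁻ x y {w} Dw
      ... | inj₁ refl = Sum.map₂ (∨-trueˡ (isPair c d t₁ t₂) ∘ ∨-trueʳ (E (deleteVerts G (pair x y)) t₁ t₂))
                                 (NbhdIs-shortcut simpleK nbx e₁ e₂)
      ... | inj₂ refl = Sum.map₂ (∨-trueʳ (E (addEdge (deleteVerts G (pair x y)) a b) t₁ t₂))
                                 (NbhdIs-shortcut simpleK nby e₁ e₂)

    low-degree-deleted : ∀ w s₁ s₂ → V K w ≡ true → s₁ ≢ s₂ → NbrsWithin K w s₁ s₂ → pair x y w ≡ true
    low-degree-deleted w s₁ s₂ Vw _ within = pair-true⁺ x y (Sum.map proj₁ proj₁ (proj₂ (low-degree⇒end Vw within)))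

  caseII-ThreeConnected : ∀ {z z′ p q} → Ends x y z z′ → NbhdIs K z p q → ¬ TwoNonadjNbrs K z′ →
                          ThreeConnected (addEdge (deleteVerts G (single z)) p q)
  caseII-ThreeConnected {z} {z′} {p} {q} ends nbz z′-not-two =
    bypass-ThreeConnected simpleK i3 bypass low-degree-deleted
      (length≤count (distinct₄ (proj₁ nbz) (z-nbr≢z′ zp) (z-nbr≢r zp) (z-nbr≢z′ zq) (z-nbr≢r zq) z′≢r)
                    (kept (endpointʳ simpleK zp) (K-irrefl zp) ∷ kept (endpointʳ simpleK zq) (K-irrefl zq)
                     ∷ kept (endpointʳ simple zz′) (G-irrefl zz′) ∷ kept (endpointʳ simple z′r) r≢z ∷ []))
    where
    H₀ : Graph N
    H₀ = addEdge (deleteVerts G (single z)) p q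

    zp : E K z p ≡ true
    zp = adjˡ {K = K} nbz

    zq : E K z q ≡ true
    zq = adjʳ {K = K} nbz

    zz′ : E G z z′ ≡ true
    zz′ = Ends-edge ends

    other-nbr : ∃[ r ] (E G z′ r ≡ true × r ≢ z × r ≢ z)
    other-nbr = nbr-outside simple three (endpointʳ simple zz′) z z

    r : Fin N
    r = proj₁ other-nbr

    z′r : E G z′ r ≡ true
    z′r = proj₁ (proj₂ other-nbr)

    r≢z : r ≢ z
    r≢z = proj₁ (proj₂ (proj₂ other-nbr))

    z-nbr≢z′ : ∀ {t} → E K z t ≡ true → t ≢ z′
    z-nbr≢z′ e refl = ≡true⇒≢false e (deleteEdge-removes ends)

    z-nbr≢r : ∀ {t} → E K z t ≡ true → t ≢ r
    z-nbr≢r e refl = triangle zz′ z′r (deleteEdge-⊆ e)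

    z′≢r : z′ ≢ r
    z′≢r z′≡r = G-irrefl z′r (sym z′≡r)

    kept : ∀ {t} → V G t ≡ true → t ≢ z → V H₀ t ≡ true
    kept Vt t≢z = ∧-true⁺ Vt (cong not (single-false t≢z))

    bypass : Bypass K H₀ (single z)
    bypass = record
      { vertices  = λ t → deleteVerts-vertex⁻ G (single z)
      ; edges     = λ u v e Du Dv → ∨-trueˡ (isPair p q u v) (deleteVerts-edge⁺ G (single z) (deleteEdge-⊆ e) Du Dv)
      ; exits     = exits
      ; shortcuts = shortcuts }
      where
      exits : ∀ w t → single z w ≡ true → E K w t ≡ true → single z t ≡ false
      exits w t Dw e with single-true⁻ {s = z} {w} Dw
      ... | refl = single-false (K-irrefl e)
      shortcuts : ∀ t₁ w t₂ → single z w ≡ true → E K t₁ w ≡ true → E K w t₂ ≡ true →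
                  t₁ ≡ t₂ ⊎ E H₀ t₁ t₂ ≡ true
      shortcuts t₁ w t₂ Dw e₁ e₂ with single-true⁻ {s = z} {w} Dw
      ... | refl = Sum.map₂ (∨-trueʳ (E (deleteVerts G (single z)) t₁ t₂)) (NbhdIs-shortcut simpleK nbz e₁ e₂)

    low-degree-deleted : ∀ w s₁ s₂ → V K w ≡ true → s₁ ≢ s₂ → NbrsWithin K w s₁ s₂ → single z w ≡ true
    low-degree-deleted w s₁ s₂ Vw s₁≢s₂ within with w ≟ z
    ... | yes _    = refl
    ... | no w≢z   = ⊥-elim (z′-not-two (subst (TwoNonadjNbrs K) w≡z′ (low-degree⇒TwoNonadjNbrs Vw s₁≢s₂ within)))
      where
      w≡z′ : w ≡ z′
      w≡z′ = Ends-other ends (proj₂ (low-degree⇒end Vw within)) w≢z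

  both-ends⇒CaseI : TwoNonadjNbrs K x → TwoNonadjNbrs K y → CaseI G x y
  both-ends⇒CaseI (a , b , nbx , ab) (c , d , nby , cd) =
    a , b , c , d , nbx , nby , ab , cd , apart (inj₁ refl) (inj₁ refl) , apart (inj₁ refl) (inj₂ refl)
                                        , apart (inj₂ refl) (inj₁ refl) , apart (inj₂ refl) (inj₂ refl)
    where
    apart : ∀ {t t′} → t ≡ a ⊎ t ≡ b → t′ ≡ c ⊎ t′ ≡ d → t ≢ t′
    apart t∈ t′∈ refl = triangle exy (deleteEdge-⊆ (Equivalence.from (proj₂ nby _) t′∈))
                                     (deleteEdge-⊆ (Equivalence.from (proj₂ nbx _) t∈))

  end-not-TwoNonadjNbrs : ¬ CaseI G x y → ¬ CaseII G x y → ∀ {w w′} → Ends x y w w′ → ¬ TwoNonadjNbrs K w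
  end-not-TwoNonadjNbrs ¬I ¬II (inj₁ (refl , _)) two = ¬II (inj₁ (two , λ two-y → ¬I (both-ends⇒CaseI two two-y)))
  end-not-TwoNonadjNbrs ¬I ¬II (inj₂ (refl , _)) two = ¬II (inj₂ (two , λ two-x → ¬I (both-ends⇒CaseI two-x two)))

  caseIII-ThreeConnected : ¬ CaseI G x y → ¬ CaseII G x y → ThreeConnected K
  caseIII-ThreeConnected ¬I ¬II = bypass-ThreeConnected simpleK i3 bypass low-degree-deleted (proj₁ three)
    where
    bypass : Bypass K K (λ _ → false)
    bypass = record
      { vertices  = λ _ Vt → Vt , refl
      ; edges     = λ _ _ e _ _ → e
      ; exits     = λ _ _ ()
      ; shortcuts = λ _ _ _ () }

    low-degree-deleted : ∀ w s₁ s₂ → V K w ≡ true → s₁ ≢ s₂ → NbrsWithin K w s₁ s₂ → false ≡ true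
    low-degree-deleted w s₁ s₂ Vw s₁≢s₂ within =
      ⊥-elim (end-not-TwoNonadjNbrs ¬I ¬II (proj₂ (low-degree⇒end Vw within))
                                    (low-degree⇒TwoNonadjNbrs Vw s₁≢s₂ within))

lemma5p4 : (N : ℕ) (G : Graph N) (a b : Fin N) →
    IsSimple G → TriangleFree G → SuperMinimally3Connected G →
    E G a b ≡ true → Internally3Connected (deleteEdge G a b) →
    (H : Graph N) → EnhancedDeletion G a b H → ThreeConnected H
lemma5p4 N G a b simple triangle-free (three , _) eab i3 H deletion = by-case deletion
  where
  open EdgeDeletion simple triangle-free three eab i3

  by-case : EnhancedDeletion G a b H → ThreeConnected H
  by-case (caseI _ _ _ _ nba nbb _ _ ≢₁ ≢₂ ≢₃ ≢₄ same) =
    ThreeConnected-SameGraph same (caseI-ThreeConnected nba nbb ≢₁ ≢₂ ≢₃ ≢₄)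
  by-case (caseII _ _ _ _ ends nbz _ not-two same) =
    ThreeConnected-SameGraph same (caseII-ThreeConnected ends nbz not-two)
  by-case (caseIII ¬I ¬II same) =
    ThreeConnected-SameGraph same (caseIII-ThreeConnected ¬I ¬II)
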